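{- Let $m,n$ be positive integers with $n\geq m+1$. Then \[ {n+m\choose m}-{n-1\choose m}\geq\frac{(m+1)n^{m-1}}{(m-1)!}. \] -}

module Defs where

-- Write R k = (n+1)(n+2)⋯(n+k) and F k = (n−1)(n−2)⋯(n−k), so that
-- m! (C(n+m,m) − C(n−1,m)) = R m − F m.  Passing from k to k+1 multiplies R by
-- n + (k+1) and F by n − (k+1), hence, exactly,
--   R' + F' = n (R + F) + (k+1) (R − F),   R' − F' = n (R − F) + (k+1) (R + F).
-- By induction R + F ≥ 2 nᵏ and n (R − F) ≥ k (k+1) nᵏ, which is the claim
-- for k = m after dividing by n m.
module Submission where

open import Defs
open import Data.Nat using (ℕ; _!; _+_; _*_; _∸_; _^_; _≤_; _<_)
open import Data.Nat.Combinatorics using (_C_; nCk≡nPk/k!)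
open import Data.Nat.Base using (zero; suc; z≤n; s≤s⁻¹)
open import Data.Nat.Properties
open import Data.Nat.Combinatorics.Base using (_P′_; _P_)
open import Data.Nat.Combinatorics.Specification
  using (nP′k≡n[n∸1P′k∸1]; nP′k≡n!/[n∸k]!; nPk≡n!/[n∸k]!; k!∣nP′k)
open import Data.Nat.DivMod using (_/_; m*[n/m]≡n)
open import Data.Nat.Tactic.RingSolver using (solve-∀)
open import Data.Product using (_,_)
open import Relation.Binary.PropositionalEquality

k!*nCk≡nP′k : ∀ {n k} → k ≤ n → k ! * (n C k) ≡ n P′ k
k!*nCk≡nP′k {n} {k} k≤n = begin
  k ! * (n C k)              ≡⟨ cong (k ! *_) (nCk≡nPk/k! k≤n) ⟩
  k ! * ((n P k) / k !)      ≡⟨ cong (λ x → k ! * (x / k !)) nPk≡nP′k ⟩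
  k ! * ((n P′ k) / k !)     ≡⟨ m*[n/m]≡n (k!∣nP′k k≤n) ⟩
  n P′ k                     ∎
  where
  open ≡-Reasoning
  instance _ = k !≢0
  nPk≡nP′k : n P k ≡ n P′ k
  nPk≡nP′k = trans (nPk≡n!/[n∸k]! k≤n) (sym (nP′k≡n!/[n∸k]! k≤n))

rising : ℕ → ℕ → ℕ
rising n k = (n + k) P′ k

falling : ℕ → ℕ → ℕ
falling n k = (n ∸ 1) P′ k

rising-suc : ∀ n k → rising n (suc k) ≡ (n + suc k) * rising n k
rising-suc n k rewrite +-suc n k = nP′k≡n[n∸1P′k∸1] (suc (n + k)) (suc k)

falling-suc : ∀ n k → falling n (suc k) ≡ (n ∸ suc k) * falling n k
falling-suc n k = cong (_* falling n k) (∸-+-assoc n 1 k)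

falling≤rising : ∀ n k → falling n k ≤ rising n k
falling≤rising n zero    = ≤-refl
falling≤rising n (suc k) = begin
  falling n (suc k)             ≡⟨ falling-suc n k ⟩
  (n ∸ suc k) * falling n k     ≤⟨ *-mono-≤ (≤-trans (m∸n≤m n (suc k)) (m≤m+n n (suc k)))
                                            (falling≤rising n k) ⟩
  (n + suc k) * rising n k      ≡⟨ rising-suc n k ⟨
  rising n (suc k)              ∎
  where open ≤-Reasoning

[n+c]r+[n∸c]f≡n[r+f]+c[r∸f] : ∀ {n c f r} → c ≤ n → f ≤ r →
         (n + c) * r + (n ∸ c) * f ≡ n * (r + f) + c * (r ∸ f)
[n+c]r+[n∸c]f≡n[r+f]+c[r∸f] {c = c} {f = f} c≤n f≤r
  with m≤n⇒∃[o]m+o≡n c≤n | m≤n⇒∃[o]m+o≡n f≤r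
... | d , refl | δ , refl rewrite m+n∸m≡n c d | m+n∸m≡n f δ = identity c d f δ
  where
  identity : ∀ c d f δ →
             (c + d + c) * (f + δ) + d * f ≡ (c + d) * (f + δ + f) + c * δ
  identity = solve-∀

[n+c]r∸[n∸c]f≡n[r∸f]+c[r+f] : ∀ {n c f r} → c ≤ n → f ≤ r →
         (n + c) * r ∸ (n ∸ c) * f ≡ n * (r ∸ f) + c * (r + f)
[n+c]r∸[n∸c]f≡n[r∸f]+c[r+f] {c = c} {f = f} c≤n f≤r
  with m≤n⇒∃[o]m+o≡n c≤n | m≤n⇒∃[o]m+o≡n f≤r
... | d , refl | δ , refl rewrite m+n∸m≡n c d | m+n∸m≡n f δ =
  trans (cong (_∸ d * f) (identity c d f δ)) (m+n∸m≡n (d * f) _)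
  where
  identity : ∀ c d f δ →
             (c + d + c) * (f + δ) ≡ d * f + ((c + d) * δ + c * (f + δ + f))
  identity = solve-∀

rising+falling-suc : ∀ {n k} → k < n →
  rising n (suc k) + falling n (suc k) ≡
  n * (rising n k + falling n k) + suc k * (rising n k ∸ falling n k)
rising+falling-suc {n} {k} k<n
  rewrite rising-suc n k | falling-suc n k =
    [n+c]r+[n∸c]f≡n[r+f]+c[r∸f] k<n (falling≤rising n k)

rising∸falling-suc : ∀ {n k} → k < n →
  rising n (suc k) ∸ falling n (suc k) ≡
  n * (rising n k ∸ falling n k) + suc k * (rising n k + falling n k)
rising∸falling-suc {n} {k} k<n
  rewrite rising-suc n k | falling-suc n k =
    [n+c]r∸[n∸c]f≡n[r∸f]+c[r+f] k<n (falling≤rising n k)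

2*n^k≤rising+falling : ∀ {n k} → k ≤ n → 2 * n ^ k ≤ rising n k + falling n k
2*n^k≤rising+falling {n} {zero}  _   = ≤-refl
2*n^k≤rising+falling {n} {suc k} k<n = begin
  2 * (n * n ^ k)                                       ≡⟨ *-comm-middle 2 n (n ^ k) ⟩
  n * (2 * n ^ k)                                       ≤⟨ *-monoʳ-≤ n (2*n^k≤rising+falling (<⇒≤ k<n)) ⟩
  n * (rising n k + falling n k)                        ≤⟨ m≤m+n _ _ ⟩
  n * (rising n k + falling n k) + suc k * (rising n k ∸ falling n k)
                                                        ≡⟨ rising+falling-suc k<n ⟨
  rising n (suc k) + falling n (suc k)                  ∎
  where
  open ≤-Reasoning
  *-comm-middle : ∀ a b c → a * (b * c) ≡ b * (a * c)
  *-comm-middle = solve-∀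

k*[1+k]*n^k≤n*[rising∸falling] : ∀ {n k} → k ≤ n →
  k * suc k * n ^ k ≤ n * (rising n k ∸ falling n k)
k*[1+k]*n^k≤n*[rising∸falling] {n} {zero}  _   = z≤n
k*[1+k]*n^k≤n*[rising∸falling] {n} {suc k} k<n = begin
  suc k * suc (suc k) * (n * n ^ k)                     ≡⟨ identity k n (n ^ k) ⟩
  n * (k * suc k * n ^ k) + n * (suc k * (2 * n ^ k))   ≤⟨ +-mono-≤
      (*-monoʳ-≤ n (k*[1+k]*n^k≤n*[rising∸falling] (<⇒≤ k<n)))
      (*-monoʳ-≤ n (*-monoʳ-≤ (suc k) (2*n^k≤rising+falling (<⇒≤ k<n)))) ⟩
  n * (n * D) + n * (suc k * S)                         ≡⟨ *-distribˡ-+ n (n * D) (suc k * S) ⟨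
  n * (n * D + suc k * S)                               ≡⟨ cong (n *_) (rising∸falling-suc k<n) ⟨
  n * (rising n (suc k) ∸ falling n (suc k))            ∎
  where
  open ≤-Reasoning
  D = rising n k ∸ falling n k
  S = rising n k + falling n k
  identity : ∀ k n x →
    suc k * suc (suc k) * (n * x) ≡ n * (k * suc k * x) + n * (suc k * (2 * x))
  identity = solve-∀

m!*[C∸C]≡rising∸falling : ∀ {m p} → m ≤ p →
  m ! * ((suc p + m) C m ∸ p C m) ≡ rising (suc p) m ∸ falling (suc p) m
m!*[C∸C]≡rising∸falling {m} {p} m≤p = begin
  m ! * ((suc p + m) C m ∸ p C m)             ≡⟨ *-distribˡ-∸ (m !) ((suc p + m) C m) (p C m) ⟩
  m ! * ((suc p + m) C m) ∸ m ! * (p C m)     ≡⟨ cong₂ _∸_ (k!*nCk≡nP′k (m≤n+m m (suc p)))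
                                                            (k!*nCk≡nP′k m≤p) ⟩
  rising (suc p) m ∸ falling (suc p) m        ∎
  where open ≡-Reasoning

lemma3p4 : (m n : ℕ) → 1 ≤ m → 1 ≤ n → m + 1 ≤ n →
    (m + 1) * n ^ (m ∸ 1) ≤ (m ∸ 1) ! * ((n + m) C m ∸ (n ∸ 1) C m)
lemma3p4 m@(suc j) n@(suc p) _ _ m+1≤n =
  *-cancelˡ-≤ m (*-cancelˡ-≤ n (begin
    n * (m * ((m + 1) * n ^ j))         ≡⟨ identity j n (n ^ j) ⟩
    m * suc m * n ^ m                   ≤⟨ k*[1+k]*n^k≤n*[rising∸falling] (<⇒≤ m<n) ⟩
    n * (rising n m ∸ falling n m)      ≡⟨ cong (n *_) (m!*[C∸C]≡rising∸falling (s≤s⁻¹ m<n)) ⟨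
    n * (m ! * C∸C)                     ≡⟨ cong (n *_) (*-assoc m (j !) C∸C) ⟩
    n * (m * (j ! * C∸C))               ∎))
  where
  open ≤-Reasoning
  C∸C = (n + m) C m ∸ (n ∸ 1) C m
  m<n : m < n
  m<n = subst (_≤ n) (+-comm m 1) m+1≤n
  identity : ∀ j n x → n * (suc j * ((suc j + 1) * x)) ≡ suc j * suc (suc j) * (n * x)
  identity = solve-∀
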